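{- Let $q$ be a prime power, $n\geq 1$, and $\alpha\in\mathbb{F}_{q^n}^*$. Let $C_1=\{(x,\mathrm{Tr}(x))_{q^n}\mid x\in\mathbb{F}_{q^n}^*\}$ and $C_2=\{(\alpha\mathrm{Tr}(y),y)_{q^n}\mid y\in\mathbb{F}_{q^n}^*\}$ in $\mathrm{PG}(1,q^n)$. Then $C_1$ and $C_2$ are disjoint if and only if the equation $\frac{x}{\mathrm{Tr}(x)}\cdot\frac{y}{\mathrm{Tr}(y)}=\alpha$ has no solution $x,y\in\mathbb{F}_{q^n}$ (with $\mathrm{Tr}(x)\mathrm{Tr}(y)\neq 0$), which happens if and only if $\alpha\notin T_1T_1$.
   Context: $\mathrm{Tr}=\mathrm{Tr}_{\mathbb{F}_{q^n}/\mathbb{F}_q}$. For a nonzero vector $(u_0,u_1)\in\mathbb{F}_{q^n}^2$, $(u_0,u_1)_{q^n}$ denotes the projective point of $\mathrm{PG}(1,q^n)$ spanned by it. $T_1=\{x\in\mathbb{F}_{q^n}\mid\mathrm{Tr}(x)=1\}$ and $T_1T_1=\{xy\mid x,y\in T_1\}$. -}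

module Defs where

open import Level using (Level; _⊔_) renaming (suc to lsuc)
open import Data.Nat using (ℕ; zero; suc; _^_; _≥_)
open import Data.Nat.Primality using (Prime)
open import Data.Fin using (Fin)
open import Data.Product using (Σ; ∃; ∃-syntax; _×_; _,_)
open import Relation.Nullary using (¬_)
open import Relation.Binary.PropositionalEquality as ≡ using (_≡_)
open import Function.Bundles using (Inverse)
open import Algebra.Bundles using (CommutativeRing)

IsPrimePower : ℕ → Set
IsPrimePower q = ∃[ p ] ∃[ k ] (Prime p × k ≥ 1 × q ≡ p ^ k)

record FiniteField (c ℓ : Level) (m : ℕ) : Set (lsuc (c ⊔ ℓ)) where
  field
    commRing : CommutativeRing c ℓ
  open CommutativeRing commRing public
  field
    nontrivial : ¬ (0# ≈ 1#)
    _⁻¹        : Carrier → Carrier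
    inverseʳ   : ∀ x → ¬ (x ≈ 0#) → x * (x ⁻¹) ≈ 1#
    card       : Inverse setoid (≡.setoid (Fin m))

  infixl 8 _^ᶠ_
  _^ᶠ_ : Carrier → ℕ → Carrier
  x ^ᶠ zero  = 1#
  x ^ᶠ suc k = x * (x ^ᶠ k)

  _/_ : Carrier → Carrier → Carrier
  x / y = x * (y ⁻¹)

module Trace {c ℓ : Level} (q n : ℕ) (F : FiniteField c ℓ (q ^ n)) where
  open FiniteField F

  trSum : ℕ → Carrier → Carrier
  trSum zero    x = 0#
  trSum (suc i) x = trSum i x + x ^ᶠ (q ^ i)

  Tr : Carrier → Carrier
  Tr x = trSum n x

  -- nonzero vectors of F², and equality of the projective points of PG(1,F) they span
  Vec2 : Set c
  Vec2 = Carrier × Carrier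

  NonZero2 : Vec2 → Set ℓ
  NonZero2 (u₀ , u₁) = ¬ (u₀ ≈ 0# × u₁ ≈ 0#)

  SamePoint : Vec2 → Vec2 → Set (c ⊔ ℓ)
  SamePoint (u₀ , u₁) (v₀ , v₁) = ∃[ λ' ] (λ' ≉ 0# × u₀ ≈ λ' * v₀ × u₁ ≈ λ' * v₁)

  InC₁ : Vec2 → Set (c ⊔ ℓ)
  InC₁ u = ∃[ x ] (x ≉ 0# × SamePoint u (x , Tr x))

  InC₂ : Carrier → Vec2 → Set (c ⊔ ℓ)
  InC₂ α u = ∃[ y ] (y ≉ 0# × SamePoint u (α * Tr y , y))

  Disjoint : Carrier → Set (c ⊔ ℓ)
  Disjoint α = ¬ (∃[ u ] (NonZero2 u × InC₁ u × InC₂ α u))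

  NoSolution : Carrier → Set (c ⊔ ℓ)
  NoSolution α = ¬ (∃[ x ] ∃[ y ] (Tr x * Tr y ≉ 0# × (x / Tr x) * (y / Tr y) ≈ α))

  T₁ : Carrier → Set ℓ
  T₁ x = Tr x ≈ 1#

  InT₁T₁ : Carrier → Set (c ⊔ ℓ)
  InT₁T₁ α = ∃[ x ] ∃[ y ] (T₁ x × T₁ y × α ≈ x * y)

-- Since q is a power of the characteristic p, z ↦ z^q is additive: p divides the inner binomial
-- coefficients of (x + y)^p, and p · 1 = 0 because the additive group has p^(kn) elements.
-- Together with z^(q^n) = z (multiplication by z ≠ 0 permutes the nonzero elements) this gives
-- Tr(z)^q = Tr(z) and Tr(d z) = d Tr(z) whenever d^q = d, hence Tr(x / Tr x) = 1 whenever Tr x ≠ 0.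
-- So the solutions of (x / Tr x)(y / Tr y) = α are exactly the factorisations α = x′y′ with
-- x′, y′ ∈ T₁. A common point λ₁(x, Tr x) = λ₂(α Tr y, y) of C₁ and C₂ forces Tr x, Tr y ≠ 0, and
-- cross-multiplying its coordinates gives xy = α Tr x Tr y, i.e. a solution; conversely a solution
-- (x, y) makes (x, Tr x) a common point.

module Submission where

open import Defs

open import Level using (Level; _⊔_)
open import Data.Nat as ℕ using (ℕ; zero; suc; NonZero; _!)
open import Data.Nat.Properties using (m^n≢0; n∸n≡0; <⇒≱; <⇒≤; <-trans; n<1+n; ∸-monoʳ-<; _!*_!≢0)
import Data.Nat.Properties as ℕₚ
open import Data.Nat.Divisibility using (_∣_; _∤_; divides; ∣⇒≤; ∣1⇒≡1; m∣m*n)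
open import Data.Nat.DivMod using (m/n*n≡m)
open import Data.Nat.Primality using (Prime; ¬prime[0]; ¬prime[1]; prime⇒nonZero; euclidsLemma)
open import Data.Nat.Combinatorics using (_C_; nCn≡1; nCk≡n!/k![n-k]!; k![n∸k]!∣n!)
open import Data.Fin as Fin using (Fin; zero; suc; fromℕ; punchIn)
open import Data.Fin.Properties using (toℕ-fromℕ; inject₁ℕ<; punchInᵢ≢i)
open import Data.Fin.Permutation using (Permutation; permutation; _⟨$⟩ʳ_; remove; punchIn-permute)
open import Data.Vec.Functional using (replicate; init)
open import Data.Product using (_,_; ∃-syntax)
open import Data.Sum using (inj₁; inj₂)
open import Function using (_∘_)
open import Function.Bundles using (Inverse; Equivalence; _⇔_; mk⇔)
open import Relation.Binary.Bundles using (Setoid)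
open import Relation.Binary.Definitions using (Decidable)
open import Relation.Binary.PropositionalEquality as ≡ using (_≡_)
open import Relation.Nullary using (¬_; yes; no; contradiction)
open import Relation.Nullary.Decidable using (map′)
open import Algebra.Bundles using (CommutativeMonoid; CommutativeSemiring)

n∣n! : ∀ n .{{_ : NonZero n}} → n ∣ n !
n∣n! (suc n) = m∣m*n (n !)

nCk*k!*[n∸k]!≡n! : ∀ {n k} → k ℕ.≤ n → (n C k) ℕ.* (k ! ℕ.* (n ℕ.∸ k) !) ≡ n !
nCk*k!*[n∸k]!≡n! {n} {k} k≤n =
  ≡.trans (≡.cong (ℕ._* (k ! ℕ.* (n ℕ.∸ k) !)) (nCk≡n!/k![n-k]! k≤n)) (m/n*n≡m (k![n∸k]!∣n! k≤n))
  where
  instance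
    k!*[n∸k]!≢0 : NonZero (k ! ℕ.* (n ℕ.∸ k) !)
    k!*[n∸k]!≢0 = k !* (n ℕ.∸ k) !≢0

module _ {p : ℕ} (p-prime : Prime p) where

  prime∤! : ∀ {k} → k ℕ.< p → p ∤ k !
  prime∤! {zero}  _   p∣1 = ¬prime[1] (≡.subst Prime (∣1⇒≡1 p∣1) p-prime)
  prime∤! {suc k} k<p p∣[1+k]! with euclidsLemma (suc k) (k !) p-prime p∣[1+k]!
  ... | inj₁ p∣1+k = <⇒≱ k<p (∣⇒≤ p∣1+k)
  ... | inj₂ p∣k!  = prime∤! (<-trans (n<1+n k) k<p) p∣k!

  prime∤k!*[p∸k]! : ∀ {k} → 0 ℕ.< k → k ℕ.< p → p ∤ k ! ℕ.* (p ℕ.∸ k) !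
  prime∤k!*[p∸k]! {k} 0<k k<p p∣k!*[p∸k]! with euclidsLemma (k !) ((p ℕ.∸ k) !) p-prime p∣k!*[p∸k]!
  ... | inj₁ p∣k!     = prime∤! k<p p∣k!
  ... | inj₂ p∣[p∸k]! = prime∤! (∸-monoʳ-< 0<k (<⇒≤ k<p)) p∣[p∸k]!

  prime∣pCk : ∀ {k} → 0 ℕ.< k → k ℕ.< p → p ∣ p C k
  prime∣pCk {k} 0<k k<p with euclidsLemma (p C k) (k ! ℕ.* (p ℕ.∸ k) !) p-prime p∣pCk*k!*[p∸k]!
    where
    p∣pCk*k!*[p∸k]! : p ∣ (p C k) ℕ.* (k ! ℕ.* (p ℕ.∸ k) !)
    p∣pCk*k!*[p∸k]! = ≡.subst (p ∣_) (≡.sym (nCk*k!*[n∸k]!≡n! (<⇒≤ k<p))) (n∣n! p {{prime⇒nonZero p-prime}})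
  ... | inj₁ p∣pCk           = p∣pCk
  ... | inj₂ p∣k!*[p∸k]!     = contradiction p∣k!*[p∸k]! (prime∤k!*[p∸k]! 0<k k<p)

module CharacteristicProperties {a ℓ} (R : CommutativeSemiring a ℓ) where

  open CommutativeSemiring R hiding (zero)
  open import Algebra.Properties.Semiring.Mult semiring using (_×_; ×-congʳ; ×-homo-1; ×-assoc-*; ×1-homo-*)
  open import Algebra.Properties.Semiring.Exp semiring using (_^_; ^-congˡ; ^-assocʳ)
  open import Algebra.Properties.CommutativeSemiring.Binomial R using (theorem; binomialTerm)
  open import Algebra.Properties.Monoid.Sum +-monoid using (sum; sum-cong-≋; sum-init-last; sum-replicate-zero)
  open import Relation.Binary.Reasoning.Setoid setoid

  ×1-homo-^ : ∀ k N → (k ℕ.^ N) × 1# ≈ (k × 1#) ^ N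
  ×1-homo-^ k zero    = ×-homo-1 1#
  ×1-homo-^ k (suc N) = trans (×1-homo-* k (k ℕ.^ N)) (*-congˡ (×1-homo-^ k N))

  ×1≈0⇒multiple-×≈0 : ∀ {p k} → p × 1# ≈ 0# → p ∣ k → ∀ x → k × x ≈ 0#
  ×1≈0⇒multiple-×≈0 {p} p×1≈0 (divides d ≡.refl) x = begin
    (d ℕ.* p) × x            ≈⟨ ×-congʳ (d ℕ.* p) (*-identityˡ x) ⟨
    (d ℕ.* p) × (1# * x)     ≈⟨ ×-assoc-* (d ℕ.* p) 1# x ⟨
    ((d ℕ.* p) × 1#) * x     ≈⟨ *-congʳ (×1-homo-* d p) ⟩
    ((d × 1#) * (p × 1#)) * x ≈⟨ *-congʳ (*-congˡ p×1≈0) ⟩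
    ((d × 1#) * 0#) * x      ≈⟨ *-congʳ (zeroʳ (d × 1#)) ⟩
    0# * x                   ≈⟨ zeroˡ x ⟩
    0# ∎

  ^-distrib-+-if-binomials≈0 : ∀ n → (∀ {k} → 0 ℕ.< k → k ℕ.< suc n → ∀ w → (suc n C k) × w ≈ 0#) →
                                ∀ x y → (x + y) ^ suc n ≈ x ^ suc n + y ^ suc n
  ^-distrib-+-if-binomials≈0 n C≈0 x y = begin
    (x + y) ^ N                                       ≈⟨ theorem N x y ⟩
    t zero + sum (t ∘ suc)                            ≈⟨ +-congˡ (sum-init-last (t ∘ suc)) ⟩
    t zero + (sum (init (t ∘ suc)) + t (fromℕ N))     ≈⟨ +-cong bottom (+-cong middle (top _ (toℕ-fromℕ N))) ⟩
    y ^ N + (0# + x ^ N)                              ≈⟨ +-comm (y ^ N) (0# + x ^ N) ⟩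
    (0# + x ^ N) + y ^ N                              ≈⟨ +-congʳ (+-identityˡ (x ^ N)) ⟩
    x ^ N + y ^ N                                     ∎
    where
    N : ℕ
    N = suc n
    t : Fin (suc N) → Carrier
    t = binomialTerm x y N
    bottom : t zero ≈ y ^ N
    bottom = trans (+-identityʳ _) (*-identityˡ _)
    middle : sum (init (t ∘ suc)) ≈ 0#
    middle = trans (sum-cong-≋ (λ i → C≈0 ℕ.z<s (ℕ.s<s (inject₁ℕ< i)) _)) (sum-replicate-zero n)
    top : ∀ j → j ≡ N → (N C j) × (x ^ j * y ^ (N ℕ.∸ j)) ≈ x ^ N
    top _ ≡.refl rewrite nCn≡1 N | n∸n≡0 N = trans (+-identityʳ _) (*-identityʳ _)

  prime-^-distrib-+ : ∀ {p} → Prime p → p × 1# ≈ 0# → ∀ x y → (x + y) ^ p ≈ x ^ p + y ^ p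
  prime-^-distrib-+ {zero}  p-prime = contradiction p-prime ¬prime[0]
  prime-^-distrib-+ {suc n} p-prime p×1≈0 =
    ^-distrib-+-if-binomials≈0 n (λ 0<k k<p → ×1≈0⇒multiple-×≈0 p×1≈0 (prime∣pCk p-prime 0<k k<p))

  prime-power-^-distrib-+ : ∀ {p} → Prime p → p × 1# ≈ 0# → ∀ j x y →
                            (x + y) ^ (p ℕ.^ j) ≈ x ^ (p ℕ.^ j) + y ^ (p ℕ.^ j)
  prime-power-^-distrib-+ p-prime p×1≈0 zero x y =
    trans (*-identityʳ (x + y)) (sym (+-cong (*-identityʳ x) (*-identityʳ y)))
  prime-power-^-distrib-+ {p} p-prime p×1≈0 (suc j) x y = begin
    (x + y) ^ (p ℕ.* p ℕ.^ j)               ≈⟨ ^-assocʳ (x + y) p (p ℕ.^ j) ⟨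
    ((x + y) ^ p) ^ (p ℕ.^ j)               ≈⟨ ^-congˡ (p ℕ.^ j) (prime-^-distrib-+ p-prime p×1≈0 x y) ⟩
    (x ^ p + y ^ p) ^ (p ℕ.^ j)             ≈⟨ prime-power-^-distrib-+ p-prime p×1≈0 j (x ^ p) (y ^ p) ⟩
    (x ^ p) ^ (p ℕ.^ j) + (y ^ p) ^ (p ℕ.^ j) ≈⟨ +-cong (^-assocʳ x p (p ℕ.^ j)) (^-assocʳ y p (p ℕ.^ j)) ⟩
    x ^ (p ℕ.* p ℕ.^ j) + y ^ (p ℕ.* p ℕ.^ j) ∎

module _ {a ℓ} (M : CommutativeMonoid a ℓ) where

  open CommutativeMonoid M
  open import Algebra.Properties.CommutativeMonoid.Sum M using (sum; sum-cong-≋; sum-replicate; ∑-distrib-+; ∑-permute)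
  open import Algebra.Properties.Monoid.Mult monoid using (_×_)
  open import Relation.Binary.Reasoning.Setoid setoid

  scaling-permutation⇒×∙sum≈sum : ∀ {k} x (g : Fin k → Carrier) (ρ : Permutation k k) →
                                   (∀ j → g (ρ ⟨$⟩ʳ j) ≈ x ∙ g j) → k × x ∙ sum g ≈ sum g
  scaling-permutation⇒×∙sum≈sum {k} x g ρ ρ-scales = begin
    k × x ∙ sum g                ≈⟨ ∙-congʳ (sum-replicate k) ⟨
    sum (replicate k x) ∙ sum g  ≈⟨ ∑-distrib-+ (replicate k x) g ⟨
    sum (λ j → x ∙ g j)          ≈⟨ sum-cong-≋ (λ j → sym (ρ-scales j)) ⟩
    sum (λ j → g (ρ ⟨$⟩ʳ j))     ≈⟨ ∑-permute g ρ ⟨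
    sum g                        ∎

module Enumeration {a ℓ m} {S : Setoid a ℓ} (card : Inverse S (≡.setoid (Fin m))) where

  open Setoid S

  index : Carrier → Fin m
  index = Inverse.to card

  element : Fin m → Carrier
  element = Inverse.from card

  element-index : ∀ x → element (index x) ≈ x
  element-index = Inverse.strictlyInverseʳ card

  index-element : ∀ i → index (element i) ≡ i
  index-element = Inverse.strictlyInverseˡ card

  _≟_ : Decidable _≈_
  x ≟ y = map′ index-injective (Inverse.to-cong card) (index x Fin.≟ index y)
    where
    index-injective : index x ≡ index y → x ≈ y
    index-injective eq = trans (sym (element-index x)) (trans (reflexive (≡.cong element eq)) (element-index y))

  module InducedPermutation (f f⁻¹ : Carrier → Carrier)
                 (f-cong : ∀ {x y} → x ≈ y → f x ≈ f y) (f⁻¹-cong : ∀ {x y} → x ≈ y → f⁻¹ x ≈ f⁻¹ y)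
                 (f∘f⁻¹ : ∀ x → f (f⁻¹ x) ≈ x) (f⁻¹∘f : ∀ x → f⁻¹ (f x) ≈ x) where

    π : Permutation m m
    π = permutation (index ∘ f ∘ element) (index ∘ f⁻¹ ∘ element)
      (λ i → ≡.trans (Inverse.to-cong card (trans (f-cong (element-index _)) (f∘f⁻¹ _))) (index-element i))
      (λ i → ≡.trans (Inverse.to-cong card (trans (f⁻¹-cong (element-index _)) (f⁻¹∘f _))) (index-element i))

    element-π : ∀ i → element (π ⟨$⟩ʳ i) ≈ f (element i)
    element-π i = element-index (f (element i))

module FiniteFieldProperties {c ℓ m} (F : FiniteField c ℓ m) where

  open FiniteField F hiding (zero)
  open Enumeration card using (_≟_)
  open import Algebra.Properties.Semiring.Mult semiring using (_×_)
  open import Algebra.Properties.Semiring.Exp semiring using (_^_)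
  open import Algebra.Properties.Group +-group using (∙-cancelʳ)
  import Algebra.Properties.Group +-group as AdditiveGroup
  open import Algebra.Properties.CommutativeMonoid.Sum *-commutativeMonoid using () renaming (sum to product)
  open CharacteristicProperties commutativeSemiring using (×1-homo-^)
  import Algebra.Solver.CommutativeMonoid *-commutativeMonoid as CMS
  open CMS using (_⊕_; _⊜_)
  open import Relation.Binary.Reasoning.Setoid setoid

  1≉0 : 1# ≉ 0#
  1≉0 1≈0 = nontrivial (sym 1≈0)

  ⁻¹-inverseˡ : ∀ {x} → x ≉ 0# → x ⁻¹ * x ≈ 1#
  ⁻¹-inverseˡ {x} x≉0 = trans (*-comm (x ⁻¹) x) (inverseʳ x x≉0)

  x⁻¹*[x*y]≈y : ∀ {x} → x ≉ 0# → ∀ y → x ⁻¹ * (x * y) ≈ y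
  x⁻¹*[x*y]≈y {x} x≉0 y = begin
    x ⁻¹ * (x * y) ≈⟨ *-assoc (x ⁻¹) x y ⟨
    x ⁻¹ * x * y   ≈⟨ *-congʳ (⁻¹-inverseˡ x≉0) ⟩
    1# * y         ≈⟨ *-identityˡ y ⟩
    y              ∎

  x*[x⁻¹*y]≈y : ∀ {x} → x ≉ 0# → ∀ y → x * (x ⁻¹ * y) ≈ y
  x*[x⁻¹*y]≈y {x} x≉0 y = begin
    x * (x ⁻¹ * y) ≈⟨ *-assoc x (x ⁻¹) y ⟨
    x * x ⁻¹ * y   ≈⟨ *-congʳ (inverseʳ x x≉0) ⟩
    1# * y         ≈⟨ *-identityˡ y ⟩
    y              ∎

  *-cancelˡ : ∀ {x y z} → x ≉ 0# → x * y ≈ x * z → y ≈ z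
  *-cancelˡ {x} {y} {z} x≉0 xy≈xz = begin
    y              ≈⟨ x⁻¹*[x*y]≈y x≉0 y ⟨
    x ⁻¹ * (x * y) ≈⟨ *-congˡ xy≈xz ⟩
    x ⁻¹ * (x * z) ≈⟨ x⁻¹*[x*y]≈y x≉0 z ⟩
    z              ∎

  x≉0∧y≉0⇒x*y≉0 : ∀ {x y} → x ≉ 0# → y ≉ 0# → x * y ≉ 0#
  x≉0∧y≉0⇒x*y≉0 {x} x≉0 y≉0 xy≈0 = y≉0 (*-cancelˡ x≉0 (trans xy≈0 (sym (zeroʳ x))))

  x*y≉0⇒x≉0 : ∀ {x y} → x * y ≉ 0# → x ≉ 0#
  x*y≉0⇒x≉0 {y = y} xy≉0 x≈0 = xy≉0 (trans (*-congʳ x≈0) (zeroˡ y))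

  x*y≉0⇒y≉0 : ∀ {x y} → x * y ≉ 0# → y ≉ 0#
  x*y≉0⇒y≉0 {x} xy≉0 y≈0 = xy≉0 (trans (*-congˡ y≈0) (zeroʳ x))

  x≉0⇒x⁻¹≉0 : ∀ {x} → x ≉ 0# → x ⁻¹ ≉ 0#
  x≉0⇒x⁻¹≉0 {x} x≉0 x⁻¹≈0 = 1≉0 (trans (sym (inverseʳ x x≉0)) (trans (*-congˡ x⁻¹≈0) (zeroʳ x)))

  x≉0⇒x^k≉0 : ∀ {x} k → x ≉ 0# → x ^ k ≉ 0#
  x≉0⇒x^k≉0 zero    x≉0 = 1≉0
  x≉0⇒x^k≉0 (suc k) x≉0 = x≉0∧y≉0⇒x*y≉0 x≉0 (x≉0⇒x^k≉0 k x≉0)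

  [x*y]/y≈x : ∀ {x y} → y ≉ 0# → (x * y) / y ≈ x
  [x*y]/y≈x {x} {y} y≉0 = begin
    x * y * y ⁻¹   ≈⟨ *-assoc x y (y ⁻¹) ⟩
    x * (y * y ⁻¹) ≈⟨ *-congˡ (inverseʳ y y≉0) ⟩
    x * 1#         ≈⟨ *-identityʳ x ⟩
    x              ∎

  [x/y]*y≈x : ∀ {x y} → y ≉ 0# → (x / y) * y ≈ x
  [x/y]*y≈x {x} {y} y≉0 = begin
    x * y ⁻¹ * y   ≈⟨ *-assoc x (y ⁻¹) y ⟩
    x * (y ⁻¹ * y) ≈⟨ *-congˡ (⁻¹-inverseˡ y≉0) ⟩
    x * 1#         ≈⟨ *-identityʳ x ⟩
    x              ∎

  [a/c]*[b/d]*[c*d]≈a*b : ∀ {a b c d} → c ≉ 0# → d ≉ 0# → (a / c) * (b / d) * (c * d) ≈ a * b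
  [a/c]*[b/d]*[c*d]≈a*b {a} {b} {c} {d} c≉0 d≉0 = begin
    (a * c ⁻¹) * (b * d ⁻¹) * (c * d)      ≈⟨ CMS.solve 6 (λ a b c c⁻¹ d d⁻¹ →
                                                ((a ⊕ c⁻¹) ⊕ (b ⊕ d⁻¹)) ⊕ (c ⊕ d) ⊜ (a ⊕ b) ⊕ ((c ⊕ c⁻¹) ⊕ (d ⊕ d⁻¹)))
                                              refl a b c (c ⁻¹) d (d ⁻¹) ⟩
    (a * b) * ((c * c ⁻¹) * (d * d ⁻¹))    ≈⟨ *-congˡ (*-cong (inverseʳ c c≉0) (inverseʳ d d≉0)) ⟩
    (a * b) * (1# * 1#)                    ≈⟨ *-congˡ (*-identityˡ 1#) ⟩
    (a * b) * 1#                           ≈⟨ *-identityʳ (a * b) ⟩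
    a * b                                  ∎

  [a/c]*[b/d]≈e⇔a*b≈e*[c*d] : ∀ {a b c d e} → c * d ≉ 0# → ((a / c) * (b / d) ≈ e ⇔ a * b ≈ e * (c * d))
  [a/c]*[b/d]≈e⇔a*b≈e*[c*d] {a} {b} {c} {d} {e} cd≉0 = mk⇔
    (λ eq → trans (sym ([a/c]*[b/d]*[c*d]≈a*b c≉0 d≉0)) (*-congʳ eq))
    (λ eq → *-cancelˡ cd≉0 (begin
      (c * d) * ((a / c) * (b / d)) ≈⟨ *-comm (c * d) _ ⟩
      (a / c) * (b / d) * (c * d)   ≈⟨ [a/c]*[b/d]*[c*d]≈a*b c≉0 d≉0 ⟩
      a * b                         ≈⟨ eq ⟩
      e * (c * d)                   ≈⟨ *-comm e (c * d) ⟩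
      (c * d) * e                   ∎))
    where
    c≉0 : c ≉ 0#
    c≉0 = x*y≉0⇒x≉0 cd≉0
    d≉0 : d ≉ 0#
    d≉0 = x*y≉0⇒y≉0 cd≉0

  product-≉0 : ∀ {r} (g : Fin r → Carrier) → (∀ j → g j ≉ 0#) → product g ≉ 0#
  product-≉0 {zero}  g g≉0 = 1≉0
  product-≉0 {suc r} g g≉0 = x≉0∧y≉0⇒x*y≉0 (g≉0 zero) (product-≉0 (g ∘ suc) (g≉0 ∘ suc))

  m×x≈0 : ∀ x → m × x ≈ 0#
  m×x≈0 x = ∙-cancelʳ (sum element) (m × x) 0# (begin
    m × x + sum element ≈⟨ scaling-permutation⇒×∙sum≈sum +-commutativeMonoid x element π element-π ⟩
    sum element         ≈⟨ +-identityˡ (sum element) ⟨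
    0# + sum element    ∎)
    where
    open import Algebra.Properties.Monoid.Sum +-monoid using (sum)
    open Enumeration card
    x+[-x+y]≈y : ∀ y → x + (- x + y) ≈ y
    x+[-x+y]≈y = AdditiveGroup.\\-leftDividesˡ x
    -x+[x+y]≈y : ∀ y → - x + (x + y) ≈ y
    -x+[x+y]≈y = AdditiveGroup.\\-leftDividesʳ x
    open InducedPermutation (x +_) (- x +_) +-congˡ +-congˡ x+[-x+y]≈y -x+[x+y]≈y

  -- The m = k + 1 elements are enumerated by card₁; removing the index of 0 enumerates the nonzero ones by Fin k.
  x≉0⇒x^k≈1 : ∀ {k} → Inverse setoid (≡.setoid (Fin (suc k))) → ∀ {x} → x ≉ 0# → x ^ k ≈ 1#
  x≉0⇒x^k≈1 {k} card₁ {x} x≉0 = *-cancelˡ (product-≉0 g g≉0) (begin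
    product g * x ^ k ≈⟨ *-comm (product g) (x ^ k) ⟩
    x ^ k * product g ≈⟨ scaling-permutation⇒×∙sum≈sum *-commutativeMonoid x g ρ ρ-scales ⟩
    product g         ≈⟨ *-identityʳ (product g) ⟨
    product g * 1#    ∎)
    where
    open Enumeration card₁
    open InducedPermutation (x *_) (x ⁻¹ *_) *-congˡ *-congˡ (x*[x⁻¹*y]≈y x≉0) (x⁻¹*[x*y]≈y x≉0)
    z : Fin (suc k)
    z = index 0#
    π-fixes-z : π ⟨$⟩ʳ z ≡ z
    π-fixes-z = Inverse.to-cong card₁ (trans (*-congˡ (element-index 0#)) (zeroʳ x))
    ρ : Permutation k k
    ρ = remove z π
    g : Fin k → Carrier
    g j = element (punchIn z j)
    g≉0 : ∀ j → g j ≉ 0#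
    g≉0 j gj≈0 = punchInᵢ≢i z j (≡.trans (≡.sym (index-element (punchIn z j))) (Inverse.to-cong card₁ gj≈0))
    punchIn-ρ : ∀ j → punchIn z (ρ ⟨$⟩ʳ j) ≡ π ⟨$⟩ʳ punchIn z j
    punchIn-ρ j = ≡.trans (≡.cong (λ i → punchIn i (ρ ⟨$⟩ʳ j)) (≡.sym π-fixes-z)) (≡.sym (punchIn-permute π z j))
    ρ-scales : ∀ j → g (ρ ⟨$⟩ʳ j) ≈ x * g j
    ρ-scales j = trans (reflexive (≡.cong element (punchIn-ρ j))) (element-π (punchIn z j))

  x^m≈x : ∀ x → x ^ m ≈ x
  x^m≈x = fermat card
    where
    fermat : ∀ {k} → Inverse setoid (≡.setoid (Fin k)) → ∀ x → x ^ k ≈ x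
    fermat {zero}  card₀ x with Inverse.to card₀ x
    ... | ()
    fermat {suc k} card₁ x with Enumeration._≟_ card₁ x 0#
    ... | yes x≈0 = trans (*-congʳ x≈0) (trans (zeroˡ (x ^ k)) (sym x≈0))
    ... | no  x≉0 = trans (*-congˡ (x≉0⇒x^k≈1 card₁ x≉0)) (*-identityʳ x)

  card≡p^N⇒p×1≈0 : ∀ {p N} → m ≡ p ℕ.^ N → p × 1# ≈ 0#
  card≡p^N⇒p×1≈0 {p} {N} m≡p^N with (p × 1#) ≟ 0#
  ... | yes p×1≈0 = p×1≈0
  ... | no  p×1≉0 = contradiction (begin
    (p × 1#) ^ N     ≈⟨ ×1-homo-^ p N ⟨
    (p ℕ.^ N) × 1#   ≡⟨ ≡.cong (_× 1#) m≡p^N ⟨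
    m × 1#           ≈⟨ m×x≈0 1# ⟩
    0#               ∎) (x≉0⇒x^k≉0 N p×1≉0)

module TraceProperties {c ℓ} (q n : ℕ) (F : FiniteField c ℓ (q ℕ.^ n))
                       {p k} (p-prime : Prime p) (q≡p^k : q ≡ p ℕ.^ k) where

  open FiniteField F hiding (zero)
  open Trace q n F
  open FiniteFieldProperties F
  open CharacteristicProperties commutativeSemiring using (prime-power-^-distrib-+)
  open import Algebra.Properties.Semiring.Exp semiring using (_^_; ^-congˡ; ^-assocʳ)
  open import Algebra.Properties.CommutativeSemiring.Exp commutativeSemiring using (^-distrib-*)
  open import Algebra.Properties.Group +-group using (∙-cancelˡ)
  import Algebra.Solver.CommutativeMonoid *-commutativeMonoid as CMS
  open CMS using (_⊕_; _⊜_)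
  open import Relation.Binary.Reasoning.Setoid setoid

  instance
    q≢0 : NonZero q
    q≢0 = ≡.subst NonZero (≡.sym q≡p^k) (m^n≢0 p k {{prime⇒nonZero p-prime}})

  ^ᶠ≈^ : ∀ x j → x ^ᶠ j ≈ x ^ j
  ^ᶠ≈^ x zero    = refl
  ^ᶠ≈^ x (suc j) = *-congˡ (^ᶠ≈^ x j)

  0^j≈0 : ∀ j .{{_ : NonZero j}} → 0# ^ j ≈ 0#
  0^j≈0 (suc j) = zeroˡ (0# ^ j)

  ^q-distrib-+ : ∀ x y → (x + y) ^ q ≈ x ^ q + y ^ q
  ^q-distrib-+ = ≡.subst (λ r → ∀ x y → (x + y) ^ r ≈ x ^ r + y ^ r) (≡.sym q≡p^k)
    (prime-power-^-distrib-+ p-prime (card≡p^N⇒p×1≈0 {p} {k ℕ.* n} q^n≡p^[k*n]) k)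
    where
    q^n≡p^[k*n] : q ℕ.^ n ≡ p ℕ.^ (k ℕ.* n)
    q^n≡p^[k*n] = ≡.trans (≡.cong (ℕ._^ n) q≡p^k) (ℕₚ.^-*-assoc p k n)

  trSum-cong : ∀ i {x y} → x ≈ y → trSum i x ≈ trSum i y
  trSum-cong zero    x≈y = refl
  trSum-cong (suc i) {x} {y} x≈y = +-cong (trSum-cong i x≈y) (begin
    x ^ᶠ (q ℕ.^ i) ≈⟨ ^ᶠ≈^ x (q ℕ.^ i) ⟩
    x ^ (q ℕ.^ i)  ≈⟨ ^-congˡ (q ℕ.^ i) x≈y ⟩
    y ^ (q ℕ.^ i)  ≈⟨ ^ᶠ≈^ y (q ℕ.^ i) ⟨
    y ^ᶠ (q ℕ.^ i) ∎)

  trSum-0 : ∀ i → trSum i 0# ≈ 0#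
  trSum-0 zero    = refl
  trSum-0 (suc i) = begin
    trSum i 0# + 0# ^ᶠ (q ℕ.^ i) ≈⟨ +-cong (trSum-0 i) (^ᶠ≈^ 0# (q ℕ.^ i)) ⟩
    0# + 0# ^ (q ℕ.^ i)          ≈⟨ +-identityˡ _ ⟩
    0# ^ (q ℕ.^ i)               ≈⟨ 0^j≈0 (q ℕ.^ i) {{m^n≢0 q i}} ⟩
    0#                           ∎

  Tr≉0⇒≉0 : ∀ {x} → Tr x ≉ 0# → x ≉ 0#
  Tr≉0⇒≉0 Tr[x]≉0 x≈0 = Tr[x]≉0 (trans (trSum-cong n x≈0) (trSum-0 n))

  -- Raising to the q-th power shifts every exponent q^j of trSum to q^(j+1), so trSum telescopes.
  x+trSum^q≈trSum+x^q^i : ∀ i x → x + trSum i x ^ q ≈ trSum i x + x ^ (q ℕ.^ i)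
  x+trSum^q≈trSum+x^q^i zero x = begin
    x + 0# ^ q ≈⟨ +-congˡ (0^j≈0 q) ⟩
    x + 0#     ≈⟨ +-identityʳ x ⟩
    x          ≈⟨ *-identityʳ x ⟨
    x ^ 1      ≈⟨ +-identityˡ (x ^ 1) ⟨
    0# + x ^ 1 ∎
  x+trSum^q≈trSum+x^q^i (suc i) x = begin
    x + (S + x ^ᶠ (q ℕ.^ i)) ^ q            ≈⟨ +-congˡ (^-congˡ q (+-congˡ (^ᶠ≈^ x (q ℕ.^ i)))) ⟩
    x + (S + x ^ (q ℕ.^ i)) ^ q             ≈⟨ +-congˡ (^q-distrib-+ S (x ^ (q ℕ.^ i))) ⟩
    x + (S ^ q + (x ^ (q ℕ.^ i)) ^ q)       ≈⟨ +-assoc x (S ^ q) _ ⟨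
    (x + S ^ q) + (x ^ (q ℕ.^ i)) ^ q       ≈⟨ +-cong (x+trSum^q≈trSum+x^q^i i x) (^-assocʳ x (q ℕ.^ i) q) ⟩
    (S + x ^ (q ℕ.^ i)) + x ^ (q ℕ.^ i ℕ.* q)
      ≈⟨ +-cong (+-congˡ (^ᶠ≈^ x (q ℕ.^ i))) (reflexive (≡.cong (x ^_) (ℕₚ.*-comm q (q ℕ.^ i)))) ⟨
    (S + x ^ᶠ (q ℕ.^ i)) + x ^ (q ℕ.* q ℕ.^ i) ∎
    where
    S : Carrier
    S = trSum i x

  Tr^q≈Tr : ∀ x → Tr x ^ q ≈ Tr x
  Tr^q≈Tr x = ∙-cancelˡ x (Tr x ^ q) (Tr x) (begin
    x + Tr x ^ q          ≈⟨ x+trSum^q≈trSum+x^q^i n x ⟩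
    Tr x + x ^ (q ℕ.^ n)  ≈⟨ +-congˡ (x^m≈x x) ⟩
    Tr x + x              ≈⟨ +-comm (Tr x) x ⟩
    x + Tr x              ∎)

  ^q-fixed⇒^q^i-fixed : ∀ {d} → d ^ q ≈ d → ∀ i → d ^ (q ℕ.^ i) ≈ d
  ^q-fixed⇒^q^i-fixed {d} d^q≈d zero    = *-identityʳ d
  ^q-fixed⇒^q^i-fixed {d} d^q≈d (suc i) = begin
    d ^ (q ℕ.* q ℕ.^ i) ≈⟨ ^-assocʳ d q (q ℕ.^ i) ⟨
    (d ^ q) ^ (q ℕ.^ i) ≈⟨ ^-congˡ (q ℕ.^ i) d^q≈d ⟩
    d ^ (q ℕ.^ i)       ≈⟨ ^q-fixed⇒^q^i-fixed d^q≈d i ⟩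
    d                   ∎

  ^q-fixed⇒⁻¹-^q-fixed : ∀ {d} → d ^ q ≈ d → d ≉ 0# → (d ⁻¹) ^ q ≈ d ⁻¹
  ^q-fixed⇒⁻¹-^q-fixed {d} d^q≈d d≉0 = *-cancelˡ d≉0 (begin
    d * (d ⁻¹) ^ q     ≈⟨ *-congʳ d^q≈d ⟨
    d ^ q * (d ⁻¹) ^ q ≈⟨ ^-distrib-* d (d ⁻¹) q ⟨
    (d * d ⁻¹) ^ q     ≈⟨ ^-congˡ q (inverseʳ d d≉0) ⟩
    1# ^ q             ≈⟨ ×-idem (*-identityˡ 1#) q ⟩
    1#                 ≈⟨ inverseʳ d d≉0 ⟨
    d * d ⁻¹           ∎)
    where open import Algebra.Properties.Monoid.Mult *-monoid using (×-idem)

  trSum-linear : ∀ {d} → d ^ q ≈ d → ∀ i x → trSum i (d * x) ≈ d * trSum i x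
  trSum-linear d^q≈d zero    x = sym (zeroʳ _)
  trSum-linear {d} d^q≈d (suc i) x = begin
    trSum i (d * x) + (d * x) ^ᶠ (q ℕ.^ i)   ≈⟨ +-cong (trSum-linear d^q≈d i x) (^ᶠ≈^ (d * x) (q ℕ.^ i)) ⟩
    d * trSum i x + (d * x) ^ (q ℕ.^ i)     ≈⟨ +-congˡ (^-distrib-* d x (q ℕ.^ i)) ⟩
    d * trSum i x + d ^ (q ℕ.^ i) * x ^ (q ℕ.^ i)
      ≈⟨ +-congˡ (*-cong (^q-fixed⇒^q^i-fixed d^q≈d i) (sym (^ᶠ≈^ x (q ℕ.^ i)))) ⟩
    d * trSum i x + d * x ^ᶠ (q ℕ.^ i)      ≈⟨ distribˡ d (trSum i x) _ ⟨
    d * (trSum i x + x ^ᶠ (q ℕ.^ i))        ∎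

  Tr[x/Tr[x]]≈1 : ∀ {x} → Tr x ≉ 0# → Tr (x / Tr x) ≈ 1#
  Tr[x/Tr[x]]≈1 {x} Tr[x]≉0 = begin
    Tr (x * Tr x ⁻¹)   ≈⟨ trSum-cong n (*-comm x (Tr x ⁻¹)) ⟩
    Tr (Tr x ⁻¹ * x)   ≈⟨ trSum-linear (^q-fixed⇒⁻¹-^q-fixed (Tr^q≈Tr x) Tr[x]≉0) n x ⟩
    Tr x ⁻¹ * Tr x     ≈⟨ ⁻¹-inverseˡ Tr[x]≉0 ⟩
    1#                 ∎

  module _ (α : Carrier) where

    open import Data.Product using (_×_)

    Solvable : Set (c ⊔ ℓ)
    Solvable = ∃[ x ] ∃[ y ] (Tr x * Tr y ≉ 0# × (x / Tr x) * (y / Tr y) ≈ α)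

    CommonPoint : Set (c ⊔ ℓ)
    CommonPoint = ∃[ u ] (NonZero2 u × InC₁ u × InC₂ α u)

    solvable⇒InT₁T₁ : Solvable → InT₁T₁ α
    solvable⇒InT₁T₁ (x , y , TxTy≉0 , eq) =
      x / Tr x , y / Tr y , Tr[x/Tr[x]]≈1 (x*y≉0⇒x≉0 TxTy≉0) , Tr[x/Tr[x]]≈1 (x*y≉0⇒y≉0 TxTy≉0) , sym eq

    InT₁T₁⇒solvable : InT₁T₁ α → Solvable
    InT₁T₁⇒solvable (x , y , Tx≈1 , Ty≈1 , α≈xy) = x , y , TxTy≉0 , Equivalence.from
      ([a/c]*[b/d]≈e⇔a*b≈e*[c*d] TxTy≉0) (begin
        x * y                ≈⟨ *-identityʳ (x * y) ⟨
        x * y * 1#           ≈⟨ *-congˡ TxTy≈1 ⟨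
        x * y * (Tr x * Tr y) ≈⟨ *-congʳ α≈xy ⟨
        α * (Tr x * Tr y)    ∎)
      where
      TxTy≈1 : Tr x * Tr y ≈ 1#
      TxTy≈1 = trans (*-cong Tx≈1 Ty≈1) (*-identityˡ 1#)
      TxTy≉0 : Tr x * Tr y ≉ 0#
      TxTy≉0 TxTy≈0 = 1≉0 (trans (sym TxTy≈1) TxTy≈0)

    solvable⇒commonPoint : Solvable → CommonPoint
    solvable⇒commonPoint (x , y , TxTy≉0 , eq) =
      (x , Tr x) , (λ (_ , Tx≈0) → Tx≉0 Tx≈0) ,
      (x , Tr≉0⇒≉0 Tx≉0 , 1# , 1≉0 , sym (*-identityˡ x) , sym (*-identityˡ (Tr x))) ,
      (y , y≉0 , Tr x / y , x≉0∧y≉0⇒x*y≉0 Tx≉0 (x≉0⇒x⁻¹≉0 y≉0) , x≈[Tx/y]*[αTy] , sym ([x/y]*y≈x y≉0))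
      where
      Tx≉0 : Tr x ≉ 0#
      Tx≉0 = x*y≉0⇒x≉0 TxTy≉0
      y≉0 : y ≉ 0#
      y≉0 = Tr≉0⇒≉0 (x*y≉0⇒y≉0 TxTy≉0)
      x≈[Tx/y]*[αTy] : x ≈ (Tr x / y) * (α * Tr y)
      x≈[Tx/y]*[αTy] = begin
        x                          ≈⟨ [x*y]/y≈x y≉0 ⟨
        (x * y) / y                ≈⟨ *-congʳ (Equivalence.to ([a/c]*[b/d]≈e⇔a*b≈e*[c*d] TxTy≉0) eq) ⟩
        (α * (Tr x * Tr y)) * y ⁻¹ ≈⟨ CMS.solve 4 (λ α Tx Ty y⁻¹ → (α ⊕ (Tx ⊕ Ty)) ⊕ y⁻¹ ⊜ (Tx ⊕ y⁻¹) ⊕ (α ⊕ Ty))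
                                        refl α (Tr x) (Tr y) (y ⁻¹) ⟩
        (Tr x / y) * (α * Tr y)    ∎

    commonPoint⇒solvable : CommonPoint → Solvable
    commonPoint⇒solvable ((u₀ , u₁) , _ , (x , x≉0 , l₁ , l₁≉0 , u₀≈l₁x , u₁≈l₁Tx)
                                         , (y , y≉0 , l₂ , l₂≉0 , u₀≈l₂αTy , u₁≈l₂y)) =
      x , y , TxTy≉0 , Equivalence.from ([a/c]*[b/d]≈e⇔a*b≈e*[c*d] TxTy≉0)
                                        (*-cancelˡ (x≉0∧y≉0⇒x*y≉0 l₁≉0 l₂≉0) l₁l₂xy≈l₁l₂αTxTy)
      where
      l₁x≈l₂αTy : l₁ * x ≈ l₂ * (α * Tr y)
      l₁x≈l₂αTy = trans (sym u₀≈l₁x) u₀≈l₂αTy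
      l₂y≈l₁Tx : l₂ * y ≈ l₁ * Tr x
      l₂y≈l₁Tx = trans (sym u₁≈l₂y) u₁≈l₁Tx
      Tx≉0 : Tr x ≉ 0#
      Tx≉0 Tx≈0 = x≉0∧y≉0⇒x*y≉0 l₂≉0 y≉0 (trans l₂y≈l₁Tx (trans (*-congˡ Tx≈0) (zeroʳ l₁)))
      Ty≉0 : Tr y ≉ 0#
      Ty≉0 Ty≈0 = x≉0∧y≉0⇒x*y≉0 l₁≉0 x≉0
        (trans l₁x≈l₂αTy (trans (*-congˡ (trans (*-congˡ Ty≈0) (zeroʳ α))) (zeroʳ l₂)))
      TxTy≉0 : Tr x * Tr y ≉ 0#
      TxTy≉0 = x≉0∧y≉0⇒x*y≉0 Tx≉0 Ty≉0
      l₁l₂xy≈l₁l₂αTxTy : (l₁ * l₂) * (x * y) ≈ (l₁ * l₂) * (α * (Tr x * Tr y))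
      l₁l₂xy≈l₁l₂αTxTy = begin
        (l₁ * l₂) * (x * y)             ≈⟨ CMS.solve 4 (λ l₁ l₂ x y → (l₁ ⊕ l₂) ⊕ (x ⊕ y) ⊜ (l₁ ⊕ x) ⊕ (l₂ ⊕ y))
                                             refl l₁ l₂ x y ⟩
        (l₁ * x) * (l₂ * y)             ≈⟨ *-cong l₁x≈l₂αTy l₂y≈l₁Tx ⟩
        (l₂ * (α * Tr y)) * (l₁ * Tr x) ≈⟨ CMS.solve 5 (λ l₁ l₂ α Tx Ty →
                                               (l₂ ⊕ (α ⊕ Ty)) ⊕ (l₁ ⊕ Tx) ⊜ (l₁ ⊕ l₂) ⊕ (α ⊕ (Tx ⊕ Ty)))
                                             refl l₁ l₂ α (Tr x) (Tr y) ⟩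
        (l₁ * l₂) * (α * (Tr x * Tr y)) ∎

open import Data.Nat using (_^_; _≥_)
open import Data.Product using (_×_)
open import Relation.Nullary.Negation using (contraposition)

proposition6p5 : {c ℓ : Level} (q n : ℕ) → IsPrimePower q → n ≥ 1 →
    (F : FiniteField c ℓ (q ^ n)) → (α : FiniteField.Carrier F) →
    ¬ (FiniteField._≈_ F α (FiniteField.0# F)) →
    (Trace.Disjoint q n F α ⇔ Trace.NoSolution q n F α) ×
    (Trace.NoSolution q n F α ⇔ (¬ Trace.InT₁T₁ q n F α))
proposition6p5 q n (p , k , p-prime , _ , q≡p^k) _ F α _ =
  mk⇔ (contraposition (solvable⇒commonPoint α)) (contraposition (commonPoint⇒solvable α)) ,
  mk⇔ (contraposition (InT₁T₁⇒solvable α)) (contraposition (solvable⇒InT₁T₁ α))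
  where open TraceProperties q n F {k = k} p-prime q≡p^k
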